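{- Let $\Sigma$ be a finite alphabet and let $I$ be an infinite set of partial sequences over $\Sigma$. Then there is a partial sequence in $I$ that meets infinitely many partial sequences from $I$.
   Context: A partial sequence over $\Sigma$ is an infinite word in $\bot^*\Sigma^\omega$, where $\bot\notin\Sigma$ is a fresh symbol; it is defined at the positions where its letter is not $\bot$. Two partial sequences meet if there is a position where both are defined and carry the same letter. -}

module Defs where

open import Data.Nat using (ℕ; _<_; _≤_)
open import Data.Fin using (Fin)
open import Data.Maybe using (Maybe; just; nothing; Is-just)
open import Data.Product using (Σ; ∃; ∃-syntax; _×_; proj₁)
open import Data.List using (List)
open import Data.List.Relation.Unary.Any using (Any)
open import Relation.Binary.PropositionalEquality using (_≡_; _≗_)
open import Relation.Nullary using (¬_)

-- The alphabet Σ is represented (up to renaming) by Fin m.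
-- A word over Σ ∪ {⊥}: ⊥ is represented by 'nothing'.
Word : ℕ → Set
Word m = ℕ → Maybe (Fin m)

IsPartial : ∀ {m} → Word m → Set
IsPartial s = ∃[ k ] (∀ i → (i < k → s i ≡ nothing) × (k ≤ i → Is-just (s i)))

PSeq : ℕ → Set
PSeq m = Σ (Word m) IsPartial

_≈ₚ_ : ∀ {m} → PSeq m → PSeq m → Set
s ≈ₚ t = proj₁ s ≗ proj₁ t

Meets : ∀ {m} → PSeq m → PSeq m → Set
Meets s t = ∃[ i ] ∃[ a ] (proj₁ s i ≡ just a × proj₁ t i ≡ just a)

PSet : ℕ → Set₁
PSet m = PSeq m → Set

Covers : ∀ {m} → List (PSeq m) → PSet m → Set
Covers l I = ∀ t → I t → Any (λ u → t ≈ₚ u) l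

Infinite : ∀ {m} → PSet m → Set
Infinite I = ¬ (∃[ l ] Covers l I)

-- If every member of I met only finitely many others, one could greedily pick
-- members of I avoiding everything met by the previous picks, producing m + 1
-- pairwise non-meeting partial sequences. Far enough to the right all of them
-- are defined, so by pigeonhole two carry the same letter there and meet.
module Submission where

open import Defs
import Data.Nat as ℕ
open import Data.Nat using (ℕ; suc; _≤_; _≤?_; _⊔_; s<s⁻¹)
open import Data.Nat.Properties using (m≤m⊔n; m≤n⇒m≤o⊔n; 1+n≰n; ≰⇒>)
open import Data.Product using (∃-syntax; _×_; _,_; proj₁; proj₂)
open import Data.Fin using (Fin; zero; suc; _<_)
open import Data.Fin.Properties using (pigeonhole)
open import Data.Maybe using (just)
open import Data.List using (List; []; _++_)
open import Data.List.Relation.Unary.Any using (Any)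
open import Data.List.Relation.Unary.Any.Properties using (++⁺ˡ; ++⁺ʳ)
open import Data.Vec.Functional using (_∷_)
open import Function using (_∘_)
open import Level using (0ℓ)
open import Axiom.ExcludedMiddle using (ExcludedMiddle)
open import Axiom.DoubleNegationElimination using (DoubleNegationElimination; em⇒dne)
open import Relation.Nullary using (¬_; yes; no; contradiction)
open import Relation.Binary.PropositionalEquality using (_≡_; refl; sym; trans; cong)

start : ∀ {m} → PSeq m → ℕ
start = proj₁ ∘ proj₂

defined-from : ∀ {m} (s : PSeq m) {i} → start s ≤ i → ∃[ a ] proj₁ s i ≡ just a
defined-from (w , k , shape) {i} k≤i with w i | proj₂ (shape i) k≤i
... | just a | _ = a , refl

meets-sym : ∀ {m} {s t : PSeq m} → Meets s t → Meets t s
meets-sym (i , a , p , q) = i , a , q , p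

bounded-above : ∀ {n} (f : Fin n → ℕ) → ∃[ B ] (∀ i → f i ≤ B)
bounded-above {0} f = 0 , λ ()
bounded-above {suc n} f with bounded-above (f ∘ suc)
... | B , f≤B = f zero ⊔ B , λ
  { zero    → m≤m⊔n (f zero) B
  ; (suc i) → m≤n⇒m≤o⊔n (f zero) (f≤B i) }

pigeonhole-meets : ∀ {m n} → m ℕ.< n → (ss : Fin n → PSeq m) →
                   ∃[ i ] ∃[ j ] (i < j × Meets (ss i) (ss j))
pigeonhole-meets m<n ss =
  let B , start≤B = bounded-above (start ∘ ss)
      letterAt = λ i → defined-from (ss i) (start≤B i)
      i , j , i<j , same = pigeonhole m<n (proj₁ ∘ letterAt)
  in i , j , i<j , B , proj₁ (letterAt i) , proj₂ (letterAt i) ,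
     trans (proj₂ (letterAt j)) (cong just (sym same))

Disjoint : ∀ {m n} → (Fin n → PSeq m) → Set
Disjoint ss = ∀ {i j} → i < j → ¬ Meets (ss i) (ss j)

disjoint⇒n≤m : ∀ {m n} (ss : Fin n → PSeq m) → Disjoint ss → n ≤ m
disjoint⇒n≤m {m} {n} ss disj with n ≤? m
... | yes n≤m = n≤m
... | no n≰m with pigeonhole-meets (≰⇒> n≰m) ss
...   | i , j , i<j , meet = contradiction meet (disj i<j)

record DisjointFamily {m} (I : PSet m) (n : ℕ) : Set where
  field
    members : Fin n → PSeq m
    members∈I : ∀ i → I (members i)
    disjoint : Disjoint members
    neighbours : List (PSeq m)
    neighbours-cover : ∀ i → Covers neighbours (λ t → I t × Meets (members i) t)

module _ {m} {I : PSet m}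
         (escape : ∀ l → ∃[ t ] (I t × ¬ Any (t ≈ₚ_) l))
         (finite-neighbours : ∀ s → I s → ∃[ l ] Covers l (λ t → I t × Meets s t)) where

  extend : ∀ {n} → DisjointFamily I n → DisjointFamily I (suc n)
  extend F = record
    { members = t ∷ members
    ; members∈I = λ { zero → t∈I ; (suc i) → members∈I i }
    ; disjoint = disjoint′
    ; neighbours = proj₁ (finite-neighbours t t∈I) ++ neighbours
    ; neighbours-cover = λ
        { zero u u~t → ++⁺ˡ (proj₂ (finite-neighbours t t∈I) u u~t)
        ; (suc i) u u~i → ++⁺ʳ _ (neighbours-cover i u u~i) }
    }
    where
    open DisjointFamily F
    t = proj₁ (escape neighbours)
    t∈I = proj₁ (proj₂ (escape neighbours))
    disjoint′ : Disjoint (t ∷ members)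
    disjoint′ {zero} {suc j} _ meet =
      proj₂ (proj₂ (escape neighbours)) (neighbours-cover j t (t∈I , meets-sym {s = t} {members j} meet))
    disjoint′ {suc i} {suc j} i<j = disjoint (s<s⁻¹ i<j)

  greedy-family : ∀ n → DisjointFamily I n
  greedy-family 0 = record
    { members = λ () ; members∈I = λ () ; disjoint = λ { {()} }
    ; neighbours = [] ; neighbours-cover = λ () }
  greedy-family (suc n) = extend (greedy-family n)

module _ (dne : DoubleNegationElimination 0ℓ) {m} {I : PSet m} where

  infinite⇒escape : Infinite I → ∀ l → ∃[ t ] (I t × ¬ Any (t ≈ₚ_) l)
  infinite⇒escape inf l = dne λ none → inf (l , λ t t∈I → dne λ t∉l → none (t , t∈I , t∉l))

  no-hub⇒finite-neighbours : ¬ (∃[ s ] (I s × Infinite (λ t → I t × Meets s t))) →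
                             ∀ s → I s → ∃[ l ] Covers l (λ t → I t × Meets s t)
  no-hub⇒finite-neighbours no-hub s s∈I = dne λ infinite → no-hub (s , s∈I , infinite)

lemma4p5 : ExcludedMiddle 0ℓ → (m : ℕ) (I : PSet m) → Infinite I →
    ∃[ s ] (I s × Infinite (λ t → I t × Meets s t))
lemma4p5 em m I inf = dne λ no-hub →
  let open DisjointFamily
        (greedy-family (infinite⇒escape dne inf) (no-hub⇒finite-neighbours dne no-hub) (suc m))
  in 1+n≰n (disjoint⇒n≤m members disjoint)
  where
  dne : DoubleNegationElimination 0ℓ
  dne = em⇒dne em
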